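{- Let $K_0$ be an infinite field and let $R$ be a local integral domain which is a $K_0$-algebra. If $x_1,\ldots,x_n\in R$ form an $R$-independent sequence in $\operatorname{Frac}(R)$, and $\vec{y}\in GL_n(K_0)\cdot\vec{x}$, then $y_1,\ldots,y_n$ is also $R$-independent.
   Context: Elements $x_1,\ldots,x_n$ of an $R$-module $M$ are $R$-independent if no $x_i$ lies in the $R$-submodule generated by $\{x_j : j\neq i\}$. -}

module Defs where

open import Level using (Level; _⊔_)
open import Data.Nat using (ℕ; zero; suc)
open import Data.Fin using (Fin; zero; suc)
open import Data.Fin.Properties using (_≟_)
open import Data.Product using (Σ; ∃; _×_; _,_)
open import Data.Sum using (_⊎_)
open import Data.List using (List)
open import Data.List.Relation.Unary.Any using (Any)
open import Relation.Nullary using (¬_; yes; no)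
open import Algebra.Bundles using (CommutativeRing)
open import Algebra.Morphism.Structures using (module RingMorphisms)

module _ {c ℓ : Level} (R : CommutativeRing c ℓ) where
  open CommutativeRing R hiding (zero)

  ∑ : ∀ n → (Fin n → Carrier) → Carrier
  ∑ zero    f = 0#
  ∑ (suc n) f = f zero + ∑ n (λ j → f (suc j))

  Unit : Carrier → Set (c ⊔ ℓ)
  Unit a = ∃ λ b → a * b ≈ 1#

  IsField : Set (c ⊔ ℓ)
  IsField = (¬ 1# ≈ 0#) × (∀ a → ¬ a ≈ 0# → Unit a)

  IsInfinite : Set (c ⊔ ℓ)
  IsInfinite = ¬ (Σ (List Carrier) λ l → ∀ a → Any (a ≈_) l)

  IsIntegralDomain : Set (c ⊔ ℓ)
  IsIntegralDomain = (¬ 1# ≈ 0#) × (∀ a b → a * b ≈ 0# → a ≈ 0# ⊎ b ≈ 0#)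

  -- R is local: R ≠ 0 and the non-units form an ideal
  -- (equivalently, R has a unique maximal ideal, namely the non-units)
  IsLocal : Set (c ⊔ ℓ)
  IsLocal = (¬ 1# ≈ 0#) × (∀ a b → ¬ Unit a → ¬ Unit b → ¬ Unit (a + b))

  InSpanOfOthers : ∀ {n} → (Fin n → Carrier) → Fin n → Set (c ⊔ ℓ)
  InSpanOfOthers {n} x i =
    ∃ λ (r : Fin n → Carrier) → (r i ≈ 0#) × (x i ≈ ∑ n (λ j → r j * x j))

  Independent : ∀ {n} → (Fin n → Carrier) → Set (c ⊔ ℓ)
  Independent {n} x = ∀ i → ¬ InSpanOfOthers x i

  Mat : ℕ → Set c
  Mat n = Fin n → Fin n → Carrier

  _⊛_ : ∀ {n} → Mat n → Mat n → Mat n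
  _⊛_ {n} A B i k = ∑ n (λ j → A i j * B j k)

  idMat : ∀ {n} → Mat n
  idMat i j with i ≟ j
  ... | yes _ = 1#
  ... | no  _ = 0#

  _≈M_ : ∀ {n} → Mat n → Mat n → Set ℓ
  A ≈M B = ∀ i j → A i j ≈ B i j

  InGL : ∀ {n} → Mat n → Set (c ⊔ ℓ)
  InGL {n} A = ∃ λ (B : Mat n) → ((A ⊛ B) ≈M idMat) × ((B ⊛ A) ≈M idMat)

IsAlgebraMap : ∀ {c₁ ℓ₁ c₂ ℓ₂} (K : CommutativeRing c₁ ℓ₁) (R : CommutativeRing c₂ ℓ₂)
               → (CommutativeRing.Carrier K → CommutativeRing.Carrier R) → Set _
IsAlgebraMap K R φ =
  RingMorphisms.IsRingHomomorphism (CommutativeRing.rawRing K) (CommutativeRing.rawRing R) φ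

InGLOrbit : ∀ {c₁ ℓ₁ c₂ ℓ₂} (K : CommutativeRing c₁ ℓ₁) (R : CommutativeRing c₂ ℓ₂)
            → (CommutativeRing.Carrier K → CommutativeRing.Carrier R)
            → ∀ {n} → (Fin n → CommutativeRing.Carrier R) → (Fin n → CommutativeRing.Carrier R)
            → Set _
InGLOrbit K R φ {n} y x =
  ∃ λ (A : Mat K n) → InGL K A ×
    (∀ i → CommutativeRing._≈_ R (y i) (∑ R n (λ j → CommutativeRing._*_ R (φ (A i j)) (x j))))

module Submission where

-- Over a local ring, x₁,…,xₙ are independent exactly when every linear relation ∑ aⱼ xⱼ = 0 has all its
-- coefficients in the maximal ideal. If y = A x with A invertible, a relation a of y gives the relation
-- a A of x, and a = (a A) A⁻¹ then has its coefficients in the maximal ideal as well, because the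
-- non-units of a local ring form an ideal.

open import Defs
open import Level using (Level; _⊔_)
open import Data.Nat using (ℕ; zero; suc)
open import Data.Fin using (Fin; zero; suc)
open import Data.Fin.Properties using (_≟_)
open import Data.Product using (_,_)
open import Data.Vec.Functional using (Vector)
open import Function using (_∘_)
open import Relation.Nullary using (¬_; yes; no; contradiction)
open import Relation.Binary.PropositionalEquality as ≡ using (_≡_)
open import Algebra.Bundles using (CommutativeRing)
open import Algebra.Morphism.Structures using (module RingMorphisms)

module LinearAlgebra {r ℓ : Level} (R : CommutativeRing r ℓ) where
  open CommutativeRing R hiding (zero)
  open import Algebra.Properties.Ring ring using (-0#≈0#; -1*x≈-x; [y-z]x≈yx-zx)
  open import Algebra.Properties.CommutativeSemigroup *-commutativeSemigroup using (xy∙z≈xz∙y)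
  open import Algebra.Properties.Semiring.Sum semiring
  open import Relation.Binary.Reasoning.Setoid setoid

  ∑≈sum : ∀ n (f : Vector Carrier n) → ∑ R n f ≈ sum f
  ∑≈sum zero    f = refl
  ∑≈sum (suc n) f = +-congˡ (∑≈sum n (f ∘ suc))

  -‿distrib-sum : ∀ {n} (f : Vector Carrier n) → - sum f ≈ ∑[ i < n ] (- f i)
  -‿distrib-sum {n} f = begin
    - sum f                  ≈⟨ -1*x≈-x (sum f) ⟨
    - 1# * sum f             ≈⟨ *-distribˡ-sum (- 1#) f ⟩
    ∑[ i < n ] (- 1# * f i)  ≈⟨ sum-cong-≋ {n} (λ i → -1*x≈-x (f i)) ⟩
    ∑[ i < n ] (- f i)       ∎

  ∑-distrib-- : ∀ {n} (f g : Vector Carrier n) → ∑[ i < n ] (f i - g i) ≈ sum f - sum g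
  ∑-distrib-- f g = trans (∑-distrib-+ f (λ i → - g i)) (+-congˡ (sym (-‿distrib-sum g)))

  x-0≈x : ∀ a → a - 0# ≈ a
  x-0≈x a = trans (+-congˡ -0#≈0#) (+-identityʳ a)

  idMat-diag : ∀ {n} (i : Fin n) → idMat R i i ≈ 1#
  idMat-diag i with i ≟ i
  ... | yes _   = refl
  ... | no i≢i = contradiction ≡.refl i≢i

  idMat-suc : ∀ {n} (i j : Fin n) → idMat R (suc i) (suc j) ≡ idMat R i j
  idMat-suc i j with i ≟ j
  ... | yes _ = ≡.refl
  ... | no _  = ≡.refl

  ∑-idMatʳ : ∀ {n} (f : Vector Carrier n) k → ∑[ i < n ] (f i * idMat R i k) ≈ f k
  ∑-idMatʳ {suc n} f zero = begin
    f zero * 1# + ∑[ i < n ] (f (suc i) * 0#)  ≈⟨ +-cong (*-identityʳ _) (sum-cong-≋ {n} (λ i → zeroʳ _)) ⟩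
    f zero + ∑[ i < n ] 0#                     ≈⟨ +-congˡ (sum-replicate-zero n) ⟩
    f zero + 0#                                ≈⟨ +-identityʳ _ ⟩
    f zero                                     ∎
  ∑-idMatʳ {suc n} f (suc k) = begin
    f zero * 0# + ∑[ i < n ] (f (suc i) * idMat R (suc i) (suc k))
      ≈⟨ +-cong (zeroʳ _) (sum-cong-≋ {n} (λ i → *-congˡ (reflexive (idMat-suc i k)))) ⟩
    0# + ∑[ i < n ] (f (suc i) * idMat R i k)  ≈⟨ +-identityˡ _ ⟩
    ∑[ i < n ] (f (suc i) * idMat R i k)       ≈⟨ ∑-idMatʳ (f ∘ suc) k ⟩
    f (suc k)                                  ∎

  IsRelation : ∀ {n} → Vector Carrier n → Vector Carrier n → Set ℓ
  IsRelation {n} x a = ∑[ j < n ] (a j * x j) ≈ 0#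

  RelationsNonunit : ∀ {n} → Vector Carrier n → Set (r ⊔ ℓ)
  RelationsNonunit x = ∀ {a} → IsRelation x a → ∀ i → ¬ Unit R (a i)

  -- A relation with a unit coefficient aᵢ, divided by -aᵢ, expresses xᵢ through the others.
  independent⇒relationsNonunit : ∀ {n} {x : Vector Carrier n} → Independent R x → RelationsNonunit x
  independent⇒relationsNonunit {n} {x} independent {a} relation i (u , aᵢu≈1) =
    independent i (coeff , coeffᵢ≈0 , xᵢ≈∑coeff*x)
    where
    coeff : Vector Carrier n
    coeff k = u * (a k * idMat R k i - a k)

    coeffᵢ≈0 : coeff i ≈ 0#
    coeffᵢ≈0 = begin
      u * (a i * idMat R i i - a i)  ≈⟨ *-congˡ (+-congʳ (trans (*-congˡ (idMat-diag i)) (*-identityʳ _))) ⟩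
      u * (a i - a i)                ≈⟨ *-congˡ (-‿inverseʳ (a i)) ⟩
      u * 0#                         ≈⟨ zeroʳ u ⟩
      0#                             ∎

    term : Vector Carrier n
    term k = a k * x k

    xᵢ≈∑coeff*x : x i ≈ ∑ R n (λ k → coeff k * x k)
    xᵢ≈∑coeff*x = sym (begin
      ∑ R n (λ k → coeff k * x k)
        ≈⟨ ∑≈sum n _ ⟩
      ∑[ k < n ] (u * (a k * idMat R k i - a k) * x k)
        ≈⟨ sum-cong-≋ {n} (λ k → trans (*-assoc u _ (x k)) (*-congˡ
             (trans ([y-z]x≈yx-zx (x k) _ (a k)) (+-congʳ (xy∙z≈xz∙y (a k) _ (x k)))))) ⟩
      ∑[ k < n ] (u * (term k * idMat R k i - term k))
        ≈⟨ *-distribˡ-sum u (λ k → term k * idMat R k i - term k) ⟨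
      u * ∑[ k < n ] (term k * idMat R k i - term k)
        ≈⟨ *-congˡ (∑-distrib-- _ term) ⟩
      u * (∑[ k < n ] (term k * idMat R k i) - sum term)
        ≈⟨ *-congˡ (+-cong (∑-idMatʳ term i) (-‿cong relation)) ⟩
      u * (a i * x i - 0#)  ≈⟨ *-congˡ (x-0≈x _) ⟩
      u * (a i * x i)       ≈⟨ *-assoc u (a i) (x i) ⟨
      u * a i * x i         ≈⟨ *-congʳ (trans (*-comm u (a i)) aᵢu≈1) ⟩
      1# * x i              ≈⟨ *-identityˡ (x i) ⟩
      x i                   ∎)

  -- xᵢ = ∑ rₖ xₖ with rᵢ = 0 is the relation eᵢ - r, whose i-th coefficient is 1.
  relationsNonunit⇒independent : ∀ {n} {x : Vector Carrier n} → RelationsNonunit x → Independent R x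
  relationsNonunit⇒independent {n} {x} nonunit i (coeff , coeffᵢ≈0 , xᵢ≈∑coeff*x) =
    nonunit relation i (1# , trans (*-identityʳ _) aᵢ≈1)
    where
    a : Vector Carrier n
    a k = idMat R k i - coeff k

    aᵢ≈1 : a i ≈ 1#
    aᵢ≈1 = trans (+-cong (idMat-diag i) (-‿cong coeffᵢ≈0)) (x-0≈x 1#)

    relation : IsRelation x a
    relation = begin
      ∑[ k < n ] ((idMat R k i - coeff k) * x k)
        ≈⟨ sum-cong-≋ {n} (λ k → trans ([y-z]x≈yx-zx (x k) _ (coeff k)) (+-congʳ (*-comm _ (x k)))) ⟩
      ∑[ k < n ] (x k * idMat R k i - coeff k * x k)
        ≈⟨ ∑-distrib-- (λ k → x k * idMat R k i) (λ k → coeff k * x k) ⟩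
      ∑[ k < n ] (x k * idMat R k i) - ∑[ k < n ] (coeff k * x k)
        ≈⟨ +-cong (∑-idMatʳ x i) (-‿cong (sym (trans xᵢ≈∑coeff*x (∑≈sum n _)))) ⟩
      x i - x i  ≈⟨ -‿inverseʳ (x i) ⟩
      0#         ∎

  infixl 7 _⊙_
  _⊙_ : ∀ {n} → Vector Carrier n → Mat R n → Vector Carrier n
  _⊙_ {n} a A j = ∑[ i < n ] (a i * A i j)

  ∑-⊙ : ∀ {n} (a : Vector Carrier n) (A : Mat R n) (v : Vector Carrier n) →
        ∑[ j < n ] ((a ⊙ A) j * v j) ≈ ∑[ i < n ] (a i * ∑[ j < n ] (A i j * v j))
  ∑-⊙ {n} a A v = begin
    ∑[ j < n ] (∑[ i < n ] (a i * A i j) * v j)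
      ≈⟨ sum-cong-≋ {n} (λ j → *-distribʳ-sum (v j) (λ i → a i * A i j)) ⟩
    ∑[ j < n ] ∑[ i < n ] (a i * A i j * v j)
      ≈⟨ ∑-comm (λ i j → a i * A i j * v j) ⟨
    ∑[ i < n ] ∑[ j < n ] (a i * A i j * v j)
      ≈⟨ sum-cong-≋ {n} (λ i → trans (sum-cong-≋ {n} (λ j → *-assoc _ _ _)) (sym (*-distribˡ-sum (a i) (λ j → A i j * v j)))) ⟩
    ∑[ i < n ] (a i * ∑[ j < n ] (A i j * v j))  ∎

  ⊙-rightInverse : ∀ {n} (A B : Mat R n) → _≈M_ R (_⊛_ R A B) (idMat R) →
                   ∀ a k → (a ⊙ A ⊙ B) k ≈ a k
  ⊙-rightInverse {n} A B AB≈I a k = begin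
    ∑[ j < n ] ((a ⊙ A) j * B j k)                ≈⟨ ∑-⊙ a A (λ j → B j k) ⟩
    ∑[ i < n ] (a i * ∑[ j < n ] (A i j * B j k))
      ≈⟨ sum-cong-≋ {n} (λ i → *-congˡ (trans (sym (∑≈sum n _)) (AB≈I i k))) ⟩
    ∑[ i < n ] (a i * idMat R i k)                ≈⟨ ∑-idMatʳ a k ⟩
    a k                                           ∎

  relation-pullback : ∀ {n} {x y : Vector Carrier n} (A : Mat R n) →
                      (∀ i → y i ≈ ∑ R n (λ j → A i j * x j)) →
                      ∀ {a} → IsRelation y a → IsRelation x (a ⊙ A)
  relation-pullback {n} {x} {y} A y≈Ax {a} relation = begin
    ∑[ j < n ] ((a ⊙ A) j * x j)                  ≈⟨ ∑-⊙ a A x ⟩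
    ∑[ i < n ] (a i * ∑[ j < n ] (A i j * x j))
      ≈⟨ sum-cong-≋ {n} (λ i → *-congˡ (sym (trans (y≈Ax i) (∑≈sum n _)))) ⟩
    ∑[ i < n ] (a i * y i)                        ≈⟨ relation ⟩
    0#                                            ∎

  unit-cong : ∀ {a b} → a ≈ b → Unit R a → Unit R b
  unit-cong a≈b (u , au≈1) = u , trans (*-congʳ (sym a≈b)) au≈1

  nonunit-*ʳ : ∀ {a} b → ¬ Unit R a → ¬ Unit R (a * b)
  nonunit-*ʳ b ¬unit (u , abu≈1) = ¬unit (b * u , trans (sym (*-assoc _ b u)) abu≈1)

  nonunit-sum : IsLocal R → ∀ {n} (f : Vector Carrier n) → (∀ i → ¬ Unit R (f i)) → ¬ Unit R (sum f)
  nonunit-sum (1≉0 , _) {zero} f _ (u , 0u≈1) = 1≉0 (trans (sym 0u≈1) (zeroˡ u))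
  nonunit-sum local@(_ , nonunit-+) {suc n} f ¬unit =
    nonunit-+ _ _ (¬unit zero) (nonunit-sum local (f ∘ suc) (¬unit ∘ suc))

  relationsNonunit-⊛ : IsLocal R → ∀ {n} {x y : Vector Carrier n} (A B : Mat R n) →
                       _≈M_ R (_⊛_ R A B) (idMat R) → (∀ i → y i ≈ ∑ R n (λ j → A i j * x j)) →
                       RelationsNonunit x → RelationsNonunit y
  relationsNonunit-⊛ local A B AB≈I y≈Ax nonunitₓ {a} relation k unit =
    nonunit-sum local _ (λ j → nonunit-*ʳ (B j k) (nonunitₓ (relation-pullback A y≈Ax relation) j))
      (unit-cong (sym (⊙-rightInverse A B AB≈I a k)) unit)

  independent-⊛ : IsLocal R → ∀ {n} {x y : Vector Carrier n} (A B : Mat R n) →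
                  _≈M_ R (_⊛_ R A B) (idMat R) → (∀ i → y i ≈ ∑ R n (λ j → A i j * x j)) →
                  Independent R x → Independent R y
  independent-⊛ local A B AB≈I y≈Ax =
    relationsNonunit⇒independent ∘ relationsNonunit-⊛ local A B AB≈I y≈Ax ∘ independent⇒relationsNonunit

module AlgebraMap {k ℓₖ r ℓᵣ : Level} (K : CommutativeRing k ℓₖ) (R : CommutativeRing r ℓᵣ)
                  {φ : CommutativeRing.Carrier K → CommutativeRing.Carrier R}
                  (isAlgebraMap : IsAlgebraMap K R φ) where
  open CommutativeRing R hiding (zero)
  open RingMorphisms.IsRingHomomorphism isAlgebraMap
  open import Algebra.Properties.Semiring.Sum semiring using (sum; sum-cong-≋)
  open import Relation.Binary.Reasoning.Setoid setoid
  open LinearAlgebra R using (∑≈sum)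

  mapMat : ∀ {n} → Mat K n → Mat R n
  mapMat A i j = φ (A i j)

  φ-∑ : ∀ n (f : Fin n → CommutativeRing.Carrier K) → φ (∑ K n f) ≈ sum (φ ∘ f)
  φ-∑ zero    f = 0#-homo
  φ-∑ (suc n) f = trans (+-homo _ _) (+-congˡ (φ-∑ n (f ∘ suc)))

  φ-idMat : ∀ {n} (i j : Fin n) → φ (idMat K i j) ≈ idMat R i j
  φ-idMat i j with i ≟ j
  ... | yes _ = 1#-homo
  ... | no _  = 0#-homo

  mapMat-rightInverse : ∀ {n} {A B : Mat K n} → _≈M_ K (_⊛_ K A B) (idMat K) →
                        _≈M_ R (_⊛_ R (mapMat A) (mapMat B)) (idMat R)
  mapMat-rightInverse {n} {A} {B} AB≈I i k = begin
    ∑ R n (λ j → φ (A i j) * φ (B j k))                 ≈⟨ ∑≈sum n _ ⟩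
    sum (λ j → φ (A i j) * φ (B j k))                   ≈⟨ sum-cong-≋ {n} (λ j → *-homo (A i j) (B j k)) ⟨
    sum (λ j → φ (CommutativeRing._*_ K (A i j) (B j k))) ≈⟨ φ-∑ n _ ⟨
    φ (_⊛_ K A B i k)                                   ≈⟨ ⟦⟧-cong (AB≈I i k) ⟩
    φ (idMat K i k)                                     ≈⟨ φ-idMat i k ⟩
    idMat R i k                                         ∎

lemma3p4 : ∀ {c₁ ℓ₁ c₂ ℓ₂ : Level}
    (K₀ : CommutativeRing c₁ ℓ₁) → IsField K₀ → IsInfinite K₀ →
    (R : CommutativeRing c₂ ℓ₂) → IsIntegralDomain R → IsLocal R →
    (φ : CommutativeRing.Carrier K₀ → CommutativeRing.Carrier R) → IsAlgebraMap K₀ R φ →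
    (n : ℕ) (x y : Fin n → CommutativeRing.Carrier R) →
    Independent R x → InGLOrbit K₀ R φ y x → Independent R y
lemma3p4 K₀ _ _ R _ local φ isAlgebraMap n x y independent (A , (B , AB≈I , _) , y≈Ax) =
  independent-⊛ local (mapMat A) (mapMat B) (mapMat-rightInverse AB≈I) y≈Ax independent
  where
  open LinearAlgebra R
  open AlgebraMap K₀ R isAlgebraMap
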